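{- Let $u$ be a positive integer (regarded as a one-letter word). Then a finite word $w$ over the positive integers satisfies $uw\equiv wu$ if and only if every column of the tableau $P(w)$ contains an entry equal to $u$.
   Context: $P(v)$ is the RSK insertion tableau of the word $v$, and $\equiv$ is Knuth equivalence: $v\equiv w$ iff $P(v)=P(w)$ (equivalently, related by Knuth transpositions $xacby\leftrightarrow xcaby$ with $a\le b<c$ and $xbacy\leftrightarrow xbcay$ with $a<b\le c$). The empty word has empty tableau, which vacuously satisfies the column condition. -}

module Defs where

open import Data.Nat using (ℕ; zero; suc; _≤_; _<_; _≤ᵇ_)
open import Data.Bool using (true; false)
open import Data.List.Relation.Unary.Any using (Any)
open import Data.List using (List; []; _∷_; _++_; [_]; length; foldl)
open import Data.Product using (_×_; _,_; ∃-syntax)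
open import Data.Unit using (⊤)
import Data.Unit
open import Data.Maybe using (Maybe; just; nothing)
open import Relation.Binary.PropositionalEquality using (_≡_)

Word : Set
Word = List ℕ

-- A tableau is a list of rows, top (first) row first; each row is a list
-- of entries read left to right (English convention).
Tableau : Set
Tableau = List (List ℕ)

rowInsert : ℕ → List ℕ → List ℕ × Maybe ℕ
rowInsert x [] = (x ∷ [] , nothing)
rowInsert x (y ∷ ys) with suc x ≤ᵇ y
... | true  = (x ∷ ys , just y)
... | false with rowInsert x ys
...   | (ys' , b) = (y ∷ ys' , b)

insert : ℕ → Tableau → Tableau
insert x [] = (x ∷ []) ∷ []
insert x (r ∷ rs) with rowInsert x r
... | (r' , nothing) = r' ∷ rs
... | (r' , just y)  = r' ∷ insert y rs

P : Word → Tableau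
P w = foldl (λ T x → insert x T) [] w

_≡K_ : Word → Word → Set
v ≡K w = P v ≡ P w

_at_ : List ℕ → ℕ → Maybe ℕ
[] at j = nothing
(x ∷ xs) at zero = just x
(x ∷ xs) at suc j = xs at j

ColumnContains : Tableau → ℕ → ℕ → Set
ColumnContains T j u = Any (λ r → r at j ≡ just u) T

EveryColumnContains : Tableau → ℕ → Set
EveryColumnContains [] u = Data.Unit.⊤
EveryColumnContains (r ∷ rs) u = ∀ j → j < length r → ColumnContains (r ∷ rs) j u

-- Since the insertion tableau of a word is built by row insertion, P (w ++ [ u ]) is the row
-- insertion of u into P w, while P (u ∷ w) is the column insertion of u into P w: column insertion
-- commutes with row insertion, and inserting u into the empty tableau gives [ [ u ] ] either way.
-- So the theorem says that column and row insertion of u into a tableau T agree exactly when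
-- every column of T contains u.
--
-- Everything goes by induction on the largest letter M. A tableau with letters ≤ M is its
-- restriction T₀ to the letters < M, padded by a horizontal strip of M's out to a shape ν. Both
-- insertions act recursively on T₀, and what remains is to follow the strip, which is arithmetic
-- on the shapes μ = shape T₀ ⊆ ν. For the comparison of the two insertions of u: below the top
-- letter they agree iff they agree on T₀ and row 0 of the strip is empty; at the top letter they
-- agree iff the strip meets every column.

module Submission where

open import Defs
open import Data.Nat using (ℕ; _≤_)
open import Data.List using (List; _∷_; []; _++_)
open import Data.List.Relation.Unary.All using (All)
open import Data.Product using (_×_)
open import Function.Bundles using (_⇔_)

open import Data.Bool using (true; false; if_then_else_)
open import Data.Empty using (⊥; ⊥-elim)
open import Data.List using ([_]; length; map; foldl; replicate; filter)
open import Data.List.Extrema.Nat using (max; ⊥≤max; xs≤max)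
open import Data.List.Membership.Propositional using (_∈_)
open import Data.List.Properties
  using (length-++; length-++-comm; length-replicate; ++-assoc; ++-identityʳ; foldl-++; filter-all; filter-none; filter-++)
open import Data.List.Relation.Unary.All using ([]; _∷_)
import Data.List.Relation.Unary.All as All
import Data.List.Relation.Unary.All.Properties as All
open import Data.List.Relation.Unary.Any using (here; there)
open import Data.Maybe using (just; nothing)
open import Data.Nat using (zero; suc; _<_; _≤ᵇ_; z≤n; s≤s; _+_; _∸_)
open import Data.Nat.Properties
open import Data.Product using (_,_; proj₁; proj₂; ∃-syntax; map₁; map₂)
open import Data.Sum using (_⊎_; inj₁; inj₂)
open import Data.Unit using (⊤; tt)
open import Function using (_∘_; id)
open import Function.Bundles using (mk⇔; Equivalence)
open import Relation.Binary.Definitions using (tri<; tri≈; tri>)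
open import Relation.Binary.PropositionalEquality hiding ([_])
open import Relation.Nullary using (¬_; yes; no)

-- Shapes and horizontal strips

Shape : Set
Shape = List ℕ

_!_ : Shape → ℕ → ℕ
[] ! _ = 0
(l ∷ μ) ! zero = l
(l ∷ μ) ! suc i = μ ! i

addBox : ℕ → Shape → Shape
addBox zero [] = 1 ∷ []
addBox zero (l ∷ μ) = suc l ∷ μ
addBox (suc r) [] = 0 ∷ addBox r []
addBox (suc r) (l ∷ μ) = l ∷ addBox r μ

addBox-!-≡ : ∀ r μ → addBox r μ ! r ≡ suc (μ ! r)
addBox-!-≡ zero [] = refl
addBox-!-≡ zero (l ∷ μ) = refl
addBox-!-≡ (suc r) [] = addBox-!-≡ r []
addBox-!-≡ (suc r) (l ∷ μ) = addBox-!-≡ r μ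

addBox-!-≢ : ∀ r μ {i} → i ≢ r → addBox r μ ! i ≡ μ ! i
addBox-!-≢ zero [] {zero} i≢r = ⊥-elim (i≢r refl)
addBox-!-≢ zero [] {suc i} i≢r = refl
addBox-!-≢ zero (l ∷ μ) {zero} i≢r = ⊥-elim (i≢r refl)
addBox-!-≢ zero (l ∷ μ) {suc i} i≢r = refl
addBox-!-≢ (suc r) [] {zero} i≢r = refl
addBox-!-≢ (suc r) [] {suc i} i≢r = addBox-!-≢ r [] (i≢r ∘ cong suc)
addBox-!-≢ (suc r) (l ∷ μ) {zero} i≢r = refl
addBox-!-≢ (suc r) (l ∷ μ) {suc i} i≢r = addBox-!-≢ r μ (i≢r ∘ cong suc)

≤-addBox-! : ∀ r μ i → μ ! i ≤ addBox r μ ! i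
≤-addBox-! r μ i with i ≟ r
... | yes refl = ≤-trans (n≤1+n _) (≤-reflexive (sym (addBox-!-≡ r μ)))
... | no i≢r = ≤-reflexive (sym (addBox-!-≢ r μ i≢r))

!-beyond : ∀ μ {i} → length μ ≤ i → μ ! i ≡ 0
!-beyond [] _ = refl
!-beyond (l ∷ μ) {suc i} (s≤s le) = !-beyond μ le

addBox-comm : ∀ p q μ → addBox p (addBox q μ) ≡ addBox q (addBox p μ)
addBox-comm zero zero μ = refl
addBox-comm zero (suc q) [] = refl
addBox-comm zero (suc q) (l ∷ μ) = refl
addBox-comm (suc p) zero [] = refl
addBox-comm (suc p) zero (l ∷ μ) = refl
addBox-comm (suc p) (suc q) [] = cong (0 ∷_) (addBox-comm p q [])
addBox-comm (suc p) (suc q) (l ∷ μ) = cong (l ∷_) (addBox-comm p q μ)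

addBox-injective : ∀ {p q} μ → addBox p μ ≡ addBox q μ → p ≡ q
addBox-injective {p} {q} μ e with p ≟ q
... | yes p≡q = p≡q
... | no p≢q = ⊥-elim (1+n≢n (begin
  suc (μ ! p)       ≡⟨ addBox-!-≡ p μ ⟨
  addBox p μ ! p    ≡⟨ cong (_! p) e ⟩
  addBox q μ ! p    ≡⟨ addBox-!-≢ q μ p≢q ⟩
  μ ! p             ∎))
  where open ≡-Reasoning

addBox-cancel : ∀ {a b a′ b′} μ → a ≢ b → addBox b′ (addBox a μ) ≡ addBox a′ (addBox b μ) → a′ ≡ a × b′ ≡ b
addBox-cancel {a} {b} {a′} {b′} μ a≢b e with a′ ≟ a
... | yes refl = refl , addBox-injective (addBox a μ) (trans e (addBox-comm a b μ))
... | no a′≢a = ⊥-elim (<-irrefl refl (begin-strict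
  μ ! a                           <⟨ n<1+n _ ⟩
  suc (μ ! a)                     ≡⟨ addBox-!-≡ a μ ⟨
  addBox a μ ! a                  ≤⟨ ≤-addBox-! b′ (addBox a μ) a ⟩
  addBox b′ (addBox a μ) ! a      ≡⟨ cong (_! a) e ⟩
  addBox a′ (addBox b μ) ! a      ≡⟨ addBox-!-≢ a′ (addBox b μ) (a′≢a ∘ sym) ⟩
  addBox b μ ! a                  ≡⟨ addBox-!-≢ b μ a≢b ⟩
  μ ! a                           ∎))
  where open ≤-Reasoning

length-addBox-< : ∀ {a} μ → a < length μ → length (addBox a μ) ≡ length μ
length-addBox-< {zero} (l ∷ μ) _ = refl
length-addBox-< {suc a} (l ∷ μ) (s≤s a<n) = cong suc (length-addBox-< μ a<n)

length-addBox-length : ∀ μ → length (addBox (length μ) μ) ≡ suc (length μ)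
length-addBox-length [] = refl
length-addBox-length (l ∷ μ) = cong suc (length-addBox-length μ)

IsPartition : Shape → Set
IsPartition μ = ∀ i → μ ! suc i ≤ μ ! i

partition-antitone : ∀ μ → IsPartition μ → ∀ {i j} → i ≤ j → μ ! j ≤ μ ! i
partition-antitone μ P {j = zero} z≤n = ≤-refl
partition-antitone μ P {i} {suc j} i≤j with m≤n⇒m<n∨m≡n i≤j
... | inj₁ i<1+j = ≤-trans (P j) (partition-antitone μ P (≤-pred i<1+j))
... | inj₂ refl = ≤-refl

partition-addBox⇒≤length : ∀ a μ → IsPartition (addBox a μ) → a ≤ length μ
partition-addBox⇒≤length a μ P with a ≤? length μ
... | yes a≤n = a≤n
... | no a≰n = ⊥-elim (1+n≰n (begin
  suc (μ ! a)                  ≡⟨ addBox-!-≡ a μ ⟨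
  addBox a μ ! a               ≤⟨ partition-antitone (addBox a μ) P n≤a ⟩
  addBox a μ ! length μ        ≡⟨ addBox-!-≢ a μ (a≰n ∘ ≤-reflexive ∘ sym) ⟩
  μ ! length μ                 ≡⟨ !-beyond μ ≤-refl ⟩
  0                            ≡⟨ !-beyond μ n≤a ⟨
  μ ! a                        ∎))
  where
  open ≤-Reasoning
  n≤a = <⇒≤ (≰⇒> a≰n)

partition-addBox-step : ∀ μ p → IsPartition (addBox (suc p) μ) → μ ! suc p < μ ! p
partition-addBox-step μ p P = begin-strict
  μ ! suc p                   <⟨ n<1+n _ ⟩
  suc (μ ! suc p)             ≡⟨ addBox-!-≡ (suc p) μ ⟨
  addBox (suc p) μ ! suc p    ≤⟨ P p ⟩
  addBox (suc p) μ ! p        ≡⟨ addBox-!-≢ (suc p) μ (1+n≢n ∘ sym) ⟩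
  μ ! p                       ∎
  where open ≤-Reasoning

Positive : Shape → Set
Positive = All (0 <_)

addBox-positive : ∀ c ν → Positive ν → c ≤ length ν → Positive (addBox c ν)
addBox-positive zero [] _ _ = s≤s z≤n ∷ []
addBox-positive zero (l ∷ ν) (_ ∷ ps) _ = s≤s z≤n ∷ ps
addBox-positive (suc c) (l ∷ ν) (p ∷ ps) (s≤s c≤n) = p ∷ addBox-positive c ν ps c≤n

record HorizontalStrip (μ ν : Shape) : Set where
  constructor strip
  field
    inside : ∀ i → μ ! i ≤ ν ! i
    flat : ∀ i → ν ! suc i ≤ μ ! i
open HorizontalStrip

strip⇒partition : ∀ {μ ν} → HorizontalStrip μ ν → IsPartition ν
strip⇒partition (strip inside flat) i = ≤-trans (flat i) (inside i)

inside-addBox : ∀ a μ ν → (∀ i → μ ! i ≤ ν ! i) → μ ! a < ν ! a → ∀ i → addBox a μ ! i ≤ ν ! i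
inside-addBox a μ ν inside room i with i ≟ a
... | yes refl = subst (_≤ ν ! i) (sym (addBox-!-≡ i μ)) room
... | no i≢a = subst (_≤ ν ! i) (sym (addBox-!-≢ a μ i≢a)) (inside i)

flat-addBox : ∀ r ν μ → (∀ i → ν ! suc i ≤ μ ! i) → (∀ p → r ≡ suc p → ν ! r < μ ! p) →
  ∀ i → addBox r ν ! suc i ≤ μ ! i
flat-addBox r ν μ flat room i with suc i ≟ r
... | yes refl = subst (_≤ μ ! i) (sym (addBox-!-≡ (suc i) ν)) (room i refl)
... | no 1+i≢r = subst (_≤ μ ! i) (sym (addBox-!-≢ r ν 1+i≢r)) (flat i)

strip-addBox-0 : ∀ μ ν → HorizontalStrip μ ν → HorizontalStrip μ (addBox 0 ν)
strip-addBox-0 μ ν s = strip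
  (λ i → ≤-trans (inside s i) (≤-addBox-! 0 ν i))
  (flat-addBox 0 ν μ (flat s) (λ _ ()))

-- Row insertion

rowInsert-bump : ∀ {y x xs} → y < x → rowInsert y (x ∷ xs) ≡ (y ∷ xs , just x)
rowInsert-bump {y} {x} y<x with suc y ≤ᵇ x | ≤⇒≤ᵇ y<x
... | true | _ = refl

rowInsert-pass : ∀ {y x xs} → x ≤ y → rowInsert y (x ∷ xs) ≡ map₁ (x ∷_) (rowInsert y xs)
rowInsert-pass {y} {x} {xs} x≤y with suc y ≤ᵇ x | ≤ᵇ⇒≤ (suc y) x
... | true | y<x = ⊥-elim (<⇒≱ (y<x tt) x≤y)
... | false | _ with rowInsert y xs
... | _ = refl

rowInsert-append : ∀ {y} r → All (_≤ y) r → rowInsert y r ≡ (r ++ [ y ] , nothing)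
rowInsert-append [] [] = refl
rowInsert-append {y} (x ∷ r) (x≤y ∷ r≤y) rewrite rowInsert-pass {xs = r} x≤y | rowInsert-append r r≤y = refl

rowInsert-++-bump : ∀ {y} xs ys {xs′ b} → rowInsert y xs ≡ (xs′ , just b) →
  rowInsert y (xs ++ ys) ≡ (xs′ ++ ys , just b)
rowInsert-++-bump {y} (x ∷ xs) ys e with y <? x
... | yes y<x rewrite rowInsert-bump {xs = xs} y<x | rowInsert-bump {xs = xs ++ ys} y<x with refl ← e = refl
... | no y≮x rewrite rowInsert-pass {xs = xs} (≮⇒≥ y≮x) | rowInsert-pass {xs = xs ++ ys} (≮⇒≥ y≮x)
  with rowInsert y xs in e′
... | (_ , just _) with refl ← e rewrite rowInsert-++-bump xs ys e′ = refl

rowInsert-++-append : ∀ {y} xs ys {xs′} → rowInsert y xs ≡ (xs′ , nothing) →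
  xs′ ≡ xs ++ [ y ] × rowInsert y (xs ++ ys) ≡ map₁ (xs ++_) (rowInsert y ys)
rowInsert-++-append [] ys refl = refl , refl
rowInsert-++-append {y} (x ∷ xs) ys e with y <? x
... | yes y<x rewrite rowInsert-bump {xs = xs} y<x with () ← e
... | no y≮x rewrite rowInsert-pass {xs = xs} (≮⇒≥ y≮x) | rowInsert-pass {xs = xs ++ ys} (≮⇒≥ y≮x)
  with rowInsert y xs in e′
... | (_ , nothing) with refl ← e with rowInsert-++-append xs ys e′
... | refl , e″ rewrite e″ = refl , refl

length-rowInsert-bump : ∀ {y} xs {xs′ b} → rowInsert y xs ≡ (xs′ , just b) → length xs′ ≡ length xs
length-rowInsert-bump {y} (x ∷ xs) e with y <? x
... | yes y<x rewrite rowInsert-bump {xs = xs} y<x with refl ← e = refl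
... | no y≮x rewrite rowInsert-pass {xs = xs} (≮⇒≥ y≮x) with rowInsert y xs in e′
... | (_ , just _) with refl ← e = cong suc (length-rowInsert-bump xs e′)

length-rowInsert-append : ∀ {y} xs {xs′} → rowInsert y xs ≡ (xs′ , nothing) → length xs′ ≡ suc (length xs)
length-rowInsert-append {y} xs e with refl ← proj₁ (rowInsert-++-append xs [] e) =
  trans (length-++ xs) (+-comm (length xs) 1)

rowInsert-bumped∈ : ∀ {y} xs {xs′ b} → rowInsert y xs ≡ (xs′ , just b) → b ∈ xs
rowInsert-bumped∈ {y} (x ∷ xs) e with y <? x
... | yes y<x rewrite rowInsert-bump {xs = xs} y<x with refl ← e = here refl
... | no y≮x rewrite rowInsert-pass {xs = xs} (≮⇒≥ y≮x) with rowInsert y xs in e′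
... | (_ , just _) with refl ← e = there (rowInsert-bumped∈ xs e′)

newRow : ℕ → Tableau → ℕ
newRow x [] = 0
newRow x (r ∷ rs) with rowInsert x r
... | (_ , nothing) = 0
... | (_ , just y) = suc (newRow y rs)

shape : Tableau → Shape
shape = map length

shape-insert : ∀ y T → shape (insert y T) ≡ addBox (newRow y T) (shape T)
shape-insert y [] = refl
shape-insert y (r ∷ rs) with rowInsert y r in e
... | (_ , nothing) = cong (_∷ shape rs) (length-rowInsert-append r e)
... | (_ , just b) = cong₂ _∷_ (length-rowInsert-bump r e) (shape-insert b rs)

-- Padding by a strip of the largest letter

pad : ℕ → Tableau → Shape → Tableau
pad M S [] = []
pad M [] (l ∷ ν) = replicate l M ∷ pad M [] ν
pad M (s ∷ S) (l ∷ ν) = (s ++ replicate (l ∸ length s) M) ∷ pad M S ν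

FitsIn : Tableau → Shape → Set
FitsIn [] ν = ⊤
FitsIn (s ∷ S) [] = ⊥
FitsIn (s ∷ S) (l ∷ ν) = length s ≤ l × FitsIn S ν

AllBelow : ℕ → Tableau → Set
AllBelow M = All (All (_< M))

shape-pad : ∀ M S ν → FitsIn S ν → shape (pad M S ν) ≡ ν
shape-pad M [] [] _ = refl
shape-pad M [] (l ∷ ν) _ = cong₂ _∷_ (length-replicate l) (shape-pad M [] ν tt)
shape-pad M (s ∷ S) (l ∷ ν) (s≤l , fits) = cong₂ _∷_ length-row (shape-pad M S ν fits)
  where
  open ≡-Reasoning
  length-row : length (s ++ replicate (l ∸ length s) M) ≡ l
  length-row = begin
    length (s ++ replicate (l ∸ length s) M)      ≡⟨ length-++ s ⟩
    length s + length (replicate (l ∸ length s) M) ≡⟨ cong (length s +_) (length-replicate (l ∸ length s)) ⟩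
    length s + (l ∸ length s)                      ≡⟨ m+[n∸m]≡n s≤l ⟩
    l                                              ∎

fits-in-outer : ∀ S ν → (∀ i → shape S ! i ≤ ν ! i) → Positive (shape S) → FitsIn S ν
fits-in-outer [] ν _ _ = tt
fits-in-outer (s ∷ S) [] inside (s>0 ∷ _) = <⇒≱ s>0 (inside 0)
fits-in-outer (s ∷ S) (l ∷ ν) inside (_ ∷ S>0) = inside 0 , fits-in-outer S ν (inside ∘ suc) S>0

replicate-∷ʳ : ∀ k (M : ℕ) → replicate k M ++ [ M ] ≡ M ∷ replicate k M
replicate-∷ʳ zero M = refl
replicate-∷ʳ (suc k) M = cong (M ∷_) (replicate-∷ʳ k M)

padded-row≤ : ∀ M (s : List ℕ) k → All (_< M) s → All (_≤ M) (s ++ replicate k M)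
padded-row≤ M s k s<M = All.++⁺ (All.map <⇒≤ s<M) (All.replicate⁺ k ≤-refl)

insert-top-pad : ∀ M S ν → AllBelow M S → FitsIn S ν →
  insert M (pad M S ν) ≡ pad M S (addBox 0 ν) × newRow M (pad M S ν) ≡ 0
insert-top-pad M [] [] _ _ = refl , refl
insert-top-pad M [] (l ∷ ν) _ _ rewrite rowInsert-append (replicate l M) (All.replicate⁺ l ≤-refl) =
  cong (_∷ pad M [] ν) (replicate-∷ʳ l M) , refl
insert-top-pad M (s ∷ S) (l ∷ ν) (s<M ∷ _) (s≤l , _)
  rewrite rowInsert-append (s ++ replicate (l ∸ length s) M) (padded-row≤ M s (l ∸ length s) s<M)
        | +-∸-assoc 1 s≤l =
  cong (_∷ pad M S ν) (trans (++-assoc s _ [ M ]) (cong (s ++_) (replicate-∷ʳ (l ∸ length s) M))) , refl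

-- When the inner tableau gains a box in row a under row insertion, the padded tableau gains its
-- box in row rowTarget a μ ν: if row a of the strip is nonempty, its first M is bumped to the end
-- of row a + 1.
rowTarget : ℕ → Shape → Shape → ℕ
rowTarget a μ ν with μ ! a <? ν ! a
... | yes _ = suc a
... | no _ = a

rowTarget-< : ∀ a μ ν → μ ! a < ν ! a → rowTarget a μ ν ≡ suc a
rowTarget-< a μ ν lt with μ ! a <? ν ! a
... | yes _ = refl
... | no ≮ = ⊥-elim (≮ lt)

rowTarget-≮ : ∀ a μ ν → ¬ μ ! a < ν ! a → rowTarget a μ ν ≡ a
rowTarget-≮ a μ ν ≮ with μ ! a <? ν ! a
... | yes lt = ⊥-elim (≮ lt)
... | no _ = refl

rowTarget-suc : ∀ a x μ l ν → rowTarget (suc a) (x ∷ μ) (l ∷ ν) ≡ suc (rowTarget a μ ν)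
rowTarget-suc a x μ l ν with μ ! a <? ν ! a
... | yes _ = refl
... | no _ = refl

rowTarget-cong : ∀ a μ ν μ′ ν′ → μ ! a ≡ μ′ ! a → ν ! a ≡ ν′ ! a → rowTarget a μ ν ≡ rowTarget a μ′ ν′
rowTarget-cong a μ ν μ′ ν′ p q with μ ! a <? ν ! a
... | yes lt = sym (rowTarget-< a μ′ ν′ (subst₂ _<_ p q lt))
... | no ≮ = sym (rowTarget-≮ a μ′ ν′ (≮ ∘ subst₂ _<_ (sym p) (sym q)))

insert-pad : ∀ M y S ν → y < M → AllBelow M S → FitsIn S ν →
  let r = rowTarget (newRow y S) (shape S) ν in
  insert y (pad M S ν) ≡ pad M (insert y S) (addBox r ν) × newRow y (pad M S ν) ≡ r
insert-pad M y [] [] y<M _ _ = refl , refl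
insert-pad M y [] (zero ∷ ν) y<M _ _ = refl , refl
insert-pad M y [] (suc l ∷ ν) y<M _ _ rewrite rowInsert-bump {xs = replicate l M} y<M =
  cong ((y ∷ replicate l M) ∷_) (proj₁ top) , cong suc (proj₂ top)
  where top = insert-top-pad M [] ν [] tt
insert-pad M y (s ∷ S) (l ∷ ν) y<M (s<M ∷ S<M) (s≤l , fits) with rowInsert y s in e
... | (s′ , just b)
  rewrite rowInsert-++-bump s (replicate (l ∸ length s) M) e
        | rowTarget-suc (newRow b S) (length s) (shape S) l ν
        | length-rowInsert-bump s e
  = cong ((s′ ++ replicate (l ∸ length s) M) ∷_) (proj₁ ih) , cong suc (proj₂ ih)
  where ih = insert-pad M b S ν (All.lookup s<M (rowInsert-bumped∈ s e)) S<M fits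
... | (s′ , nothing) with rowInsert-++-append s (replicate (l ∸ length s) M) e
... | (refl , e′) rewrite e′ with l ∸ length s in room
... | zero
  rewrite rowTarget-≮ 0 (length s ∷ shape S) (l ∷ ν) (≤⇒≯ (m∸n≡0⇒m≤n room))
        | m≤n⇒m∸n≡0 (≤-trans (s≤s (m∸n≡0⇒m≤n room)) (≤-reflexive (sym (length-++-comm s [ y ]))))
  = cong (_∷ pad M S ν) (sym (++-identityʳ (s ++ [ y ]))) , refl
... | suc k
  rewrite rowInsert-bump {xs = replicate k M} y<M
        | rowTarget-< 0 (length s ∷ shape S) (l ∷ ν) (m∸n≢0⇒n<m (λ none → 0≢1+n (trans (sym none) room)))
        | length-++-comm s [ y ]
        | sym (pred[m∸n]≡m∸[1+n] l (length s)) | room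
  = cong₂ _∷_ (sym (++-assoc s [ y ] (replicate k M))) (proj₁ top) , cong suc (proj₂ top)
  where top = insert-top-pad M S ν S<M fits

restrict : ℕ → Tableau → Tableau
restrict M [] = []
restrict M (r ∷ rs) with filter (_<? M) r
... | [] = []
... | x ∷ xs = (x ∷ xs) ∷ restrict M rs

filter-<-replicate : ∀ M k → filter (_<? M) (replicate k M) ≡ []
filter-<-replicate M k = filter-none (_<? M) (All.replicate⁺ k (<-irrefl refl))

restrict-pad : ∀ M S ν → AllBelow M S → Positive (shape S) → FitsIn S ν → restrict M (pad M S ν) ≡ S
restrict-pad M [] [] _ _ _ = refl
restrict-pad M [] (l ∷ ν) _ _ _ rewrite filter-<-replicate M l = refl
restrict-pad M ((x ∷ xs) ∷ S) (l ∷ ν) (s<M ∷ S<M) (_ ∷ S>0) (_ , fits)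
  rewrite filter-++ (_<? M) (x ∷ xs) (replicate (l ∸ length (x ∷ xs)) M)
        | filter-all (_<? M) s<M
        | filter-<-replicate M (l ∸ length (x ∷ xs))
        | ++-identityʳ (x ∷ xs)
  = cong ((x ∷ xs) ∷_) (restrict-pad M S ν S<M S>0 fits)

-- The strip under column insertion

Flush : Shape → Shape → ℕ → Set
Flush μ ν k = μ ! k ≤ ν ! suc k

Blocked : Shape → Shape → ℕ → Set
Blocked μ ν zero = ⊤
Blocked μ ν (suc t) = ¬ Flush μ ν t

-- When the inner tableau gains a box in row b under column insertion, the displaced M climbs the
-- strip: the outer box lands in the highest row t ≤ b such that the strip is flush in all rows from
-- t to b (columnTarget-unique).
columnTarget : ℕ → Shape → Shape → ℕ
columnTarget zero μ ν = zero
columnTarget (suc k) μ ν with μ ! k ≤? ν ! suc k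
... | yes _ = columnTarget k μ ν
... | no _ = suc k

columnTarget-flush : ∀ k μ ν → Flush μ ν k → columnTarget (suc k) μ ν ≡ columnTarget k μ ν
columnTarget-flush k μ ν flush with μ ! k ≤? ν ! suc k
... | yes _ = refl
... | no ¬flush = ⊥-elim (¬flush flush)

columnTarget-blocked-at : ∀ k μ ν → ¬ Flush μ ν k → columnTarget (suc k) μ ν ≡ suc k
columnTarget-blocked-at k μ ν ¬flush with μ ! k ≤? ν ! suc k
... | yes flush = ⊥-elim (¬flush flush)
... | no _ = refl

columnTarget-≤ : ∀ b μ ν → columnTarget b μ ν ≤ b
columnTarget-≤ zero μ ν = z≤n
columnTarget-≤ (suc k) μ ν with μ ! k ≤? ν ! suc k
... | yes _ = m≤n⇒m≤1+n (columnTarget-≤ k μ ν)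
... | no _ = ≤-refl

columnTarget-blocked : ∀ b μ ν → Blocked μ ν (columnTarget b μ ν)
columnTarget-blocked zero μ ν = tt
columnTarget-blocked (suc k) μ ν with μ ! k ≤? ν ! suc k
... | yes _ = columnTarget-blocked k μ ν
... | no ¬flush = ¬flush

columnTarget-flush-above : ∀ b μ ν {k} → columnTarget b μ ν ≤ k → k < b → Flush μ ν k
columnTarget-flush-above (suc b) μ ν {k} c≤k k<1+b with μ ! b ≤? ν ! suc b
... | no _ = ⊥-elim (<⇒≱ k<1+b c≤k)
... | yes flush with m≤n⇒m<n∨m≡n (≤-pred k<1+b)
...   | inj₁ k<b = columnTarget-flush-above b μ ν c≤k k<b
...   | inj₂ refl = flush

columnTarget-unique : ∀ b μ ν {t} → t ≤ b → Blocked μ ν t → (∀ k → t ≤ k → k < b → Flush μ ν k) →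
  columnTarget b μ ν ≡ t
columnTarget-unique b μ ν {t} t≤b blocked flush with m≤n⇒m<n∨m≡n t≤b
columnTarget-unique (suc b) μ ν _ blocked flush | inj₁ t<1+b =
  trans (columnTarget-flush b μ ν (flush b (≤-pred t<1+b) ≤-refl))
        (columnTarget-unique b μ ν (≤-pred t<1+b) blocked (λ k t≤k k<b → flush k t≤k (m<n⇒m<1+n k<b)))
columnTarget-unique zero μ ν _ _ _ | inj₂ refl = refl
columnTarget-unique (suc b) μ ν _ blocked _ | inj₂ refl = columnTarget-blocked-at b μ ν blocked

columnTarget-self : ∀ a μ ν → Blocked μ ν a → columnTarget a μ ν ≡ a
columnTarget-self a μ ν blocked = columnTarget-unique a μ ν ≤-refl blocked (λ k a≤k k<a → ⊥-elim (<⇒≱ k<a a≤k))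

columnTarget-above-blocked : ∀ b μ ν {t} → Blocked μ ν t → t ≤ b → t ≤ columnTarget b μ ν
columnTarget-above-blocked b μ ν {zero} _ _ = z≤n
columnTarget-above-blocked b μ ν {suc p} blocked 1+p≤b with suc p ≤? columnTarget b μ ν
... | yes ok = ok
... | no c≯p = ⊥-elim (blocked (columnTarget-flush-above b μ ν (≤-pred (≰⇒> c≯p)) 1+p≤b))

columnTarget-cong : ∀ b μ ν μ′ ν′ → (∀ k → k < b → Flush μ ν k ⇔ Flush μ′ ν′ k) →
  columnTarget b μ ν ≡ columnTarget b μ′ ν′
columnTarget-cong zero μ ν μ′ ν′ _ = refl
columnTarget-cong (suc b) μ ν μ′ ν′ flush⇔ with μ ! b ≤? ν ! suc b | μ′ ! b ≤? ν′ ! suc b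
... | yes _ | yes _ = columnTarget-cong b μ ν μ′ ν′ (λ k k<b → flush⇔ k (m<n⇒m<1+n k<b))
... | yes p | no ¬q = ⊥-elim (¬q (Equivalence.to (flush⇔ b ≤-refl) p))
... | no ¬p | yes q = ⊥-elim (¬p (Equivalence.from (flush⇔ b ≤-refl) q))
... | no _ | no _ = refl

columnTarget-addBox-0 : ∀ b μ ν → columnTarget b μ (addBox 0 ν) ≡ columnTarget b μ ν
columnTarget-addBox-0 b μ ν = columnTarget-cong b μ (addBox 0 ν) μ ν λ k _ →
  let eq = addBox-!-≢ 0 ν {suc k} (λ ()) in mk⇔ (subst (μ ! k ≤_) eq) (subst (μ ! k ≤_) (sym eq))

strip-columnTarget : ∀ b μ ν → HorizontalStrip μ ν → HorizontalStrip μ (addBox (columnTarget b μ ν) ν)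
strip-columnTarget b μ ν s = strip
  (λ i → ≤-trans (inside s i) (≤-addBox-! (columnTarget b μ ν) ν i))
  (flat-addBox (columnTarget b μ ν) ν μ (flat s) room)
  where
  room : ∀ p → columnTarget b μ ν ≡ suc p → ν ! columnTarget b μ ν < μ ! p
  room p c≡1+p with blocked ← columnTarget-blocked b μ ν rewrite c≡1+p = ≰⇒> blocked

columnTarget-room : ∀ b μ ν → HorizontalStrip μ ν → IsPartition (addBox b μ) →
  μ ! b < addBox (columnTarget b μ ν) ν ! b
columnTarget-room b μ ν s P with columnTarget b μ ν ≟ b
... | yes c≡b rewrite c≡b | addBox-!-≡ b ν = s≤s (inside s b)
columnTarget-room zero μ ν s P | no c≢0 = ⊥-elim (c≢0 (n≤0⇒n≡0 (columnTarget-≤ 0 μ ν)))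
columnTarget-room (suc p) μ ν s P | no c≢b = begin-strict
  μ ! suc p                                     <⟨ partition-addBox-step μ p P ⟩
  μ ! p                                         ≤⟨ columnTarget-flush-above (suc p) μ ν c≤p ≤-refl ⟩
  ν ! suc p                                     ≤⟨ ≤-addBox-! (columnTarget (suc p) μ ν) ν (suc p) ⟩
  addBox (columnTarget (suc p) μ ν) ν ! suc p   ∎
  where
  open ≤-Reasoning
  c≤p = ≤-pred (≤∧≢⇒< (columnTarget-≤ (suc p) μ ν) c≢b)

strip-addBox-columnTarget : ∀ b μ ν → HorizontalStrip μ ν → IsPartition (addBox b μ) →
  HorizontalStrip (addBox b μ) (addBox (columnTarget b μ ν) ν)
strip-addBox-columnTarget b μ ν s P = strip
  (inside-addBox b μ (addBox (columnTarget b μ ν) ν) (inside s′) (columnTarget-room b μ ν s P))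
  (λ i → ≤-trans (flat s′ i) (≤-addBox-! b μ i))
  where s′ = strip-columnTarget b μ ν s

strip-addBox-rowTarget : ∀ a μ ν → HorizontalStrip μ ν → IsPartition (addBox a μ) →
  HorizontalStrip (addBox a μ) (addBox (rowTarget a μ ν) ν)
strip-addBox-rowTarget a μ ν s P with μ ! a <? ν ! a
... | yes μa<νa = strip
  (inside-addBox a μ (addBox (suc a) ν) (λ i → ≤-trans (inside s i) (≤-addBox-! (suc a) ν i))
    (≤-trans μa<νa (≤-addBox-! (suc a) ν a)))
  (flat-addBox (suc a) ν (addBox a μ) (λ i → ≤-trans (flat s i) (≤-addBox-! a μ i)) λ { p refl → room })
  where
  room : ν ! suc a < addBox a μ ! a
  room = subst (ν ! suc a <_) (sym (addBox-!-≡ a μ)) (s≤s (flat s a))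
... | no μa≮νa = strip
  (inside-addBox a μ (addBox a ν) (λ i → ≤-trans (inside s i) (≤-addBox-! a ν i))
    (subst (μ ! a <_) (sym (addBox-!-≡ a ν)) (s≤s (inside s a))))
  (flat-addBox a ν (addBox a μ) (λ i → ≤-trans (flat s i) (≤-addBox-! a μ i)) room)
  where
  room : ∀ p → a ≡ suc p → ν ! a < addBox a μ ! p
  room p refl = begin-strict
    ν ! suc p              ≡⟨ ≤-antisym (≮⇒≥ μa≮νa) (inside s (suc p)) ⟩
    μ ! suc p              <⟨ partition-addBox-step μ p P ⟩
    μ ! p                  ≤⟨ ≤-addBox-! (suc p) μ p ⟩
    addBox (suc p) μ ! p   ∎
    where open ≤-Reasoning

strip-addBox-full : ∀ a μ ν → HorizontalStrip μ ν → IsPartition (addBox a μ) → ν ! a ≡ μ ! a →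
  HorizontalStrip (addBox a μ) (addBox a ν)
strip-addBox-full a μ ν s P full =
  subst (λ r → HorizontalStrip (addBox a μ) (addBox r ν)) (rowTarget-≮ a μ ν (<-irrefl (sym full)))
        (strip-addBox-rowTarget a μ ν s P)

flush-addBox-diagonal : ∀ a μ ν k → Flush (addBox a μ) (addBox (suc a) ν) k ⇔ Flush μ ν k
flush-addBox-diagonal a μ ν k with k ≟ a
... | yes refl rewrite addBox-!-≡ k μ | addBox-!-≡ (suc k) ν = mk⇔ ≤-pred s≤s
... | no k≢a rewrite addBox-!-≢ a μ k≢a | addBox-!-≢ (suc a) ν (k≢a ∘ suc-injective) = mk⇔ id id

flush-addBox-away : ∀ a μ ν k → k ≢ a → suc k ≢ a → Flush (addBox a μ) (addBox a ν) k ⇔ Flush μ ν k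
flush-addBox-away a μ ν k k≢a 1+k≢a rewrite addBox-!-≢ a μ k≢a | addBox-!-≢ a ν 1+k≢a = mk⇔ id id

flush-addBox-before : ∀ a μ ν k → suc k < a → Flush (addBox a μ) (addBox a ν) k ⇔ Flush μ ν k
flush-addBox-before a μ ν k 1+k<a = flush-addBox-away a μ ν k (<⇒≢ (<-trans (n<1+n k) 1+k<a)) (<⇒≢ 1+k<a)

flush-addBox-after : ∀ a μ ν k → a < k → Flush (addBox a μ) (addBox a ν) k ⇔ Flush μ ν k
flush-addBox-after a μ ν k a<k = flush-addBox-away a μ ν k (≢-sym (<⇒≢ a<k)) (≢-sym (<⇒≢ (m<n⇒m<1+n a<k)))

rowTarget-addBox-other : ∀ a b μ ν → a ≢ b → rowTarget a (addBox b μ) ν ≡ rowTarget a μ ν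
rowTarget-addBox-other a b μ ν a≢b = rowTarget-cong a (addBox b μ) ν μ ν (addBox-!-≢ b μ a≢b) refl

ShiftedRow : Shape → ℕ → ℕ → Set
ShiftedRow ν p q = q ≡ p ⊎ (q ≡ suc p × ν ! suc p ≡ ν ! p)

-- Row insertion adds a box to the inner shape μ in row a and column insertion adds one in row b;
-- performed after the other insertion, they add boxes in rows a′ and b′ respectively.
StripsCommute : Shape → Shape → ℕ → ℕ → ℕ → ℕ → Set
StripsCommute μ ν a b a′ b′ =
  addBox (columnTarget b′ (addBox a μ) (addBox r ν)) (addBox r ν) ≡ addBox r′ (addBox c ν)
  × (r ≡ c → ShiftedRow ν r r′)
  where
  r = rowTarget a μ ν
  c = columnTarget b μ ν
  r′ = rowTarget a′ (addBox b μ) (addBox c ν)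

strips-commute-bump : ∀ μ ν a b → a ≢ b → μ ! a < ν ! a → StripsCommute μ ν a b a b
strips-commute-bump μ ν a b a≢b μa<νa
  rewrite rowTarget-< a μ ν μa<νa
        | columnTarget-cong b (addBox a μ) (addBox (suc a) ν) μ ν (λ k _ → flush-addBox-diagonal a μ ν k)
        | rowTarget-addBox-other a b μ (addBox (columnTarget b μ ν) ν) a≢b
        | rowTarget-< a μ (addBox (columnTarget b μ ν) ν) (≤-trans μa<νa (≤-addBox-! (columnTarget b μ ν) ν a))
  = addBox-comm (columnTarget b μ ν) (suc a) ν , λ _ → inj₁ refl

blocked-at-full-row : ∀ μ ν a → HorizontalStrip μ ν → IsPartition (addBox a μ) → ν ! a ≡ μ ! a → Blocked μ ν a
blocked-at-full-row μ ν zero s P full = tt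
blocked-at-full-row μ ν (suc p) s P full flush =
  <⇒≱ (partition-addBox-step μ p P) (subst (μ ! p ≤_) full flush)

¬flush-at-new-box : ∀ μ ν a → HorizontalStrip μ ν → ¬ Flush (addBox a μ) (addBox a ν) a
¬flush-at-new-box μ ν a s flush = 1+n≰n (begin
  suc (μ ! a)                 ≡⟨ addBox-!-≡ a μ ⟨
  addBox a μ ! a              ≤⟨ flush ⟩
  addBox a ν ! suc a          ≡⟨ addBox-!-≢ a ν (1+n≢n) ⟩
  ν ! suc a                   ≤⟨ flat s a ⟩
  μ ! a                       ∎)
  where open ≤-Reasoning

rowTarget-full : ∀ a μ ν c → ν ! a ≡ μ ! a → c ≢ a → rowTarget a μ (addBox c ν) ≡ a
rowTarget-full a μ ν c full c≢a = rowTarget-≮ a μ (addBox c ν) λ lt →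
  <-irrefl (sym full) (subst (μ ! a <_) (addBox-!-≢ c ν (c≢a ∘ sym)) lt)

strips-commute-full-below : ∀ μ ν a b → ν ! a ≡ μ ! a → b < a → StripsCommute μ ν a b a b
strips-commute-full-below μ ν a b full b<a
  rewrite rowTarget-≮ a μ ν (<-irrefl (sym full))
        | columnTarget-cong b (addBox a μ) (addBox a ν) μ ν
            (λ k k<b → flush-addBox-before a μ ν k (≤-<-trans k<b b<a))
        | rowTarget-addBox-other a b μ (addBox (columnTarget b μ ν) ν) (≢-sym (<⇒≢ b<a))
        | rowTarget-full a μ ν (columnTarget b μ ν) full (<⇒≢ (≤-<-trans (columnTarget-≤ b μ ν) b<a))
  = addBox-comm (columnTarget b μ ν) a ν , λ a≡c → ⊥-elim (<⇒≢ c<a (sym a≡c))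
  where c<a = ≤-<-trans (columnTarget-≤ b μ ν) b<a

blocked-addBox-after : ∀ μ ν a t → HorizontalStrip μ ν → a < t → Blocked μ ν t → Blocked (addBox a μ) (addBox a ν) t
blocked-addBox-after μ ν a (suc t) s a<1+t blocked with t ≟ a
... | yes refl = ¬flush-at-new-box μ ν t s
... | no t≢a = blocked ∘ Equivalence.to (flush-addBox-after a μ ν t (≤∧≢⇒< (≤-pred a<1+t) (t≢a ∘ sym)))

strips-commute-full-after : ∀ μ ν a b → HorizontalStrip μ ν → ν ! a ≡ μ ! a → a < b → a < columnTarget b μ ν →
  StripsCommute μ ν a b a b
strips-commute-full-after μ ν a b s full a<b a<c
  rewrite rowTarget-≮ a μ ν (<-irrefl (sym full))
        | columnTarget-unique b (addBox a μ) (addBox a ν) (columnTarget-≤ b μ ν)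
            (blocked-addBox-after μ ν a _ s a<c (columnTarget-blocked b μ ν))
            (λ k c≤k k<b → Equivalence.from (flush-addBox-after a μ ν k (<-≤-trans a<c c≤k))
                                            (columnTarget-flush-above b μ ν c≤k k<b))
        | rowTarget-addBox-other a b μ (addBox (columnTarget b μ ν) ν) (<⇒≢ a<b)
        | rowTarget-full a μ ν (columnTarget b μ ν) full (≢-sym (<⇒≢ a<c))
  = addBox-comm (columnTarget b μ ν) a ν , λ a≡c → ⊥-elim (<⇒≢ a<c a≡c)

strips-commute-full-meet : ∀ μ ν a b → HorizontalStrip μ ν → ν ! a ≡ μ ! a → a < b → columnTarget b μ ν ≡ a →
  StripsCommute μ ν a b a b
strips-commute-full-meet μ ν a b s full a<b c≡a
  rewrite rowTarget-≮ a μ ν (<-irrefl (sym full))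
        | columnTarget-unique b (addBox a μ) (addBox a ν) {suc a} a<b (¬flush-at-new-box μ ν a s)
            (λ k a<k k<b → Equivalence.from (flush-addBox-after a μ ν k a<k)
                             (columnTarget-flush-above b μ ν (≤-trans (≤-reflexive c≡a) (<⇒≤ a<k)) k<b))
        | rowTarget-addBox-other a b μ (addBox (columnTarget b μ ν) ν) (<⇒≢ a<b)
        | c≡a
        | rowTarget-< a μ (addBox a ν) (subst (μ ! a <_) (sym (addBox-!-≡ a ν)) (s≤s (≤-reflexive (sym full))))
  = refl , λ _ → inj₂ (refl , ≤-antisym (≤-trans (flat s a) (≤-reflexive (sym full)))
                                        (subst (_≤ ν ! suc a) (sym full) flush))
  where flush = columnTarget-flush-above b μ ν (≤-reflexive c≡a) a<b

strips-commute-full : ∀ μ ν a b → HorizontalStrip μ ν → IsPartition (addBox a μ) → ν ! a ≡ μ ! a → a ≢ b →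
  StripsCommute μ ν a b a b
strips-commute-full μ ν a b s P full a≢b with <-cmp a b
... | tri≈ _ a≡b _ = ⊥-elim (a≢b a≡b)
... | tri> _ _ b<a = strips-commute-full-below μ ν a b full b<a
... | tri< a<b _ _ with a <? columnTarget b μ ν
...   | yes a<c = strips-commute-full-after μ ν a b s full a<b a<c
...   | no a≮c = strips-commute-full-meet μ ν a b s full a<b
  (≤-antisym (≮⇒≥ a≮c) (columnTarget-above-blocked b μ ν (blocked-at-full-row μ ν a s P full) (<⇒≤ a<b)))

strips-commute-≢ : ∀ μ ν a b → HorizontalStrip μ ν → IsPartition (addBox a μ) → a ≢ b → StripsCommute μ ν a b a b
strips-commute-≢ μ ν a b s P a≢b with ≤-<-connex (ν ! a) (μ ! a)
... | inj₂ μa<νa = strips-commute-bump μ ν a b a≢b μa<νa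
... | inj₁ νa≤μa = strips-commute-full μ ν a b s P (≤-antisym νa≤μa (inside s a)) a≢b

addBox-full : ∀ a μ ν → ν ! a ≡ μ ! a → addBox a ν ! a ≡ addBox a μ ! a
addBox-full a μ ν full = trans (addBox-!-≡ a ν) (trans (cong suc full) (sym (addBox-!-≡ a μ)))

strips-commute-same-row-full : ∀ μ ν a → HorizontalStrip μ ν → IsPartition (addBox a μ) →
  IsPartition (addBox a (addBox a μ)) → ν ! a ≡ μ ! a → StripsCommute μ ν a a a a
strips-commute-same-row-full μ ν a s P P2 full
  rewrite rowTarget-≮ a μ ν (<-irrefl (sym full))
        | columnTarget-self a μ ν (blocked-at-full-row μ ν a s P full)
        | columnTarget-self a (addBox a μ) (addBox a ν)
            (blocked-at-full-row (addBox a μ) (addBox a ν) a (strip-addBox-full a μ ν s P full) P2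
               (addBox-full a μ ν full))
        | rowTarget-≮ a (addBox a μ) (addBox a ν) (<-irrefl (sym (addBox-full a μ ν full)))
  = refl , λ _ → inj₁ refl

blocked-at-thin-row : ∀ μ ν a → IsPartition (addBox a (addBox a μ)) → ν ! a ≤ suc (μ ! a) → Blocked μ ν a
blocked-at-thin-row μ ν zero _ _ = tt
blocked-at-thin-row μ ν (suc p) P2 νa≤ flush = <⇒≱ (begin-strict
  ν ! suc p                          ≤⟨ νa≤ ⟩
  suc (μ ! suc p)                    ≡⟨ addBox-!-≡ (suc p) μ ⟨
  addBox (suc p) μ ! suc p           <⟨ partition-addBox-step (addBox (suc p) μ) p P2 ⟩
  addBox (suc p) μ ! p               ≡⟨ addBox-!-≢ (suc p) μ (1+n≢n ∘ sym) ⟩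
  μ ! p                              ∎) flush
  where open ≤-Reasoning

room-after-column : ∀ μ ν a → IsPartition (addBox a (addBox a μ)) → μ ! a < ν ! a →
  addBox a μ ! a < addBox (columnTarget a μ ν) ν ! a
room-after-column μ ν a P2 μa<νa with suc (μ ! a) <? ν ! a
... | yes room = subst (_< addBox (columnTarget a μ ν) ν ! a) (sym (addBox-!-≡ a μ))
                       (≤-trans room (≤-addBox-! (columnTarget a μ ν) ν a))
... | no no-room rewrite columnTarget-self a μ ν (blocked-at-thin-row μ ν a P2 (≮⇒≥ no-room))
                       | addBox-!-≡ a μ | addBox-!-≡ a ν = s≤s μa<νa

strips-commute-same-row-bump : ∀ μ ν a → IsPartition (addBox a (addBox a μ)) → μ ! a < ν ! a →
  StripsCommute μ ν a a a a
strips-commute-same-row-bump μ ν a P2 μa<νa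
  rewrite rowTarget-< a μ ν μa<νa
        | columnTarget-cong a (addBox a μ) (addBox (suc a) ν) μ ν (λ k _ → flush-addBox-diagonal a μ ν k)
        | rowTarget-< a (addBox a μ) (addBox (columnTarget a μ ν) ν) (room-after-column μ ν a P2 μa<νa)
  = addBox-comm (columnTarget a μ ν) (suc a) ν ,
    λ 1+a≡c → ⊥-elim (1+n≰n (≤-trans (≤-reflexive 1+a≡c) (columnTarget-≤ a μ ν)))

rowTarget-next-row : ∀ μ ν a c → HorizontalStrip μ ν → μ ! suc a ≡ μ ! a → c ≤ a →
  rowTarget (suc a) (addBox a μ) (addBox c ν) ≡ suc a
rowTarget-next-row μ ν a c s μ-flat c≤a =
  rowTarget-≮ (suc a) (addBox a μ) (addBox c ν) λ lt → <-irrefl refl (begin-strict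
  μ ! a                        ≡⟨ μ-flat ⟨
  μ ! suc a                    ≡⟨ addBox-!-≢ a μ 1+n≢n ⟨
  addBox a μ ! suc a           <⟨ lt ⟩
  addBox c ν ! suc a           ≡⟨ addBox-!-≢ c ν (<⇒≢ (s≤s c≤a) ∘ sym) ⟩
  ν ! suc a                    ≤⟨ flat s a ⟩
  μ ! a                        ∎)
  where open ≤-Reasoning

strips-commute-next-row-bump : ∀ μ ν a → HorizontalStrip μ ν → μ ! suc a ≡ μ ! a → μ ! a < ν ! a →
  StripsCommute μ ν a a (suc a) (suc a)
strips-commute-next-row-bump μ ν a s μ-flat μa<νa
  rewrite rowTarget-< a μ ν μa<νa
        | columnTarget-cong (suc a) (addBox a μ) (addBox (suc a) ν) μ ν (λ k _ → flush-addBox-diagonal a μ ν k)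
        | columnTarget-flush a μ ν (≤-trans (≤-reflexive (sym μ-flat)) (inside s (suc a)))
        | rowTarget-next-row μ ν a (columnTarget a μ ν) s μ-flat (columnTarget-≤ a μ ν)
  = addBox-comm (columnTarget a μ ν) (suc a) ν ,
    λ 1+a≡c → ⊥-elim (1+n≰n (≤-trans (≤-reflexive 1+a≡c) (columnTarget-≤ a μ ν)))

strips-commute-next-row-full : ∀ μ ν a → HorizontalStrip μ ν → IsPartition (addBox a μ) → μ ! suc a ≡ μ ! a →
  ν ! a ≡ μ ! a → StripsCommute μ ν a a (suc a) (suc a)
strips-commute-next-row-full μ ν a s P μ-flat full
  rewrite rowTarget-≮ a μ ν (<-irrefl (sym full))
        | columnTarget-blocked-at a (addBox a μ) (addBox a ν) (¬flush-at-new-box μ ν a s)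
        | columnTarget-self a μ ν (blocked-at-full-row μ ν a s P full)
        | rowTarget-next-row μ ν a a s μ-flat ≤-refl
  = refl , λ _ → inj₂ (refl , trans ν-flat (sym full))
  where ν-flat = ≤-antisym (flat s a) (≤-trans (≤-reflexive (sym μ-flat)) (inside s (suc a)))

strips-commute : ∀ μ ν a b a′ b′ → HorizontalStrip μ ν →
  IsPartition (addBox a μ) → IsPartition (addBox b′ (addBox a μ)) →
  addBox b′ (addBox a μ) ≡ addBox a′ (addBox b μ) → (a ≡ b → ShiftedRow μ a a′) →
  StripsCommute μ ν a b a′ b′
strips-commute μ ν a b a′ b′ s P P2 E R with a ≟ b
... | no a≢b with refl , refl ← addBox-cancel μ a≢b E = strips-commute-≢ μ ν a b s P a≢b
... | yes refl with refl ← addBox-injective (addBox a μ) E | R refl | ≤-<-connex (ν ! a) (μ ! a)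
...   | inj₁ refl | inj₂ μa<νa = strips-commute-same-row-bump μ ν a P2 μa<νa
...   | inj₁ refl | inj₁ νa≤μa = strips-commute-same-row-full μ ν a s P P2 (≤-antisym νa≤μa (inside s a))
...   | inj₂ (refl , μ-flat) | inj₂ μa<νa = strips-commute-next-row-bump μ ν a s μ-flat μa<νa
...   | inj₂ (refl , μ-flat) | inj₁ νa≤μa =
  strips-commute-next-row-full μ ν a s P μ-flat (≤-antisym νa≤μa (inside s a))

TopStripsCommute : Shape → Shape → ℕ → Set
TopStripsCommute μ ν a =
  addBox (columnTarget (length (addBox a μ)) (addBox a μ) (addBox r ν)) (addBox r ν) ≡ addBox r′ (addBox c ν)
  × (r ≡ c → ShiftedRow ν r r′)
  where
  r = rowTarget a μ ν
  c = columnTarget (length μ) μ ν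
  r′ = rowTarget a μ (addBox c ν)

strips-commute-top : ∀ μ ν a → HorizontalStrip μ ν → IsPartition (addBox a μ) → TopStripsCommute μ ν a
strips-commute-top μ ν a s P with m≤n⇒m<n∨m≡n (partition-addBox⇒≤length a μ P)
... | inj₁ a<n
  rewrite length-addBox-< μ a<n
        | sym (rowTarget-addBox-other a (length μ) μ (addBox (columnTarget (length μ) μ ν) ν) (<⇒≢ a<n))
  = strips-commute-≢ μ ν a (length μ) s P (<⇒≢ a<n)
... | inj₂ refl
  rewrite length-addBox-length μ
        | sym (columnTarget-flush (length μ) μ ν
                 (subst (_≤ ν ! suc (length μ)) (sym (!-beyond μ ≤-refl)) z≤n))
        | sym (rowTarget-addBox-other (length μ) (suc (length μ)) μ
                 (addBox (columnTarget (suc (length μ)) μ ν) ν) (<⇒≢ (n<1+n (length μ))))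
  = strips-commute-≢ μ ν (length μ) (suc (length μ)) s P (<⇒≢ (n<1+n (length μ)))

-- Semistandard tableaux and column insertion

-- Semistandard tableaux with entries < M, built one letter at a time: the cells holding M - 1
-- form a horizontal strip around the smaller entries.
data SSYT : ℕ → Tableau → Set where
  empty : SSYT 0 []
  extend : ∀ {M T ν} → SSYT M T → HorizontalStrip (shape T) ν → Positive ν → SSYT (suc M) (pad M T ν)

ssyt-positive : ∀ {M T} → SSYT M T → Positive (shape T)
fits-in-strip : ∀ {M T ν} → SSYT M T → HorizontalStrip (shape T) ν → FitsIn T ν

ssyt-positive empty = []
ssyt-positive (extend {M} {T} {ν} t s pos) = subst Positive (sym (shape-pad M T ν (fits-in-strip t s))) pos

fits-in-strip {T = T} {ν} t s = fits-in-outer T ν (inside s) (ssyt-positive t)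

shape-extend : ∀ {M T ν} → SSYT M T → HorizontalStrip (shape T) ν → shape (pad M T ν) ≡ ν
shape-extend {M} {T} {ν} t s = shape-pad M T ν (fits-in-strip t s)

ssyt-partition : ∀ {M T} → SSYT M T → IsPartition (shape T)
ssyt-partition empty _ = z≤n
ssyt-partition (extend t s pos) = subst IsPartition (sym (shape-extend t s)) (strip⇒partition s)

pad-below : ∀ M S ν → AllBelow (suc M) S → AllBelow (suc M) (pad M S ν)
pad-below M S [] _ = []
pad-below M [] (l ∷ ν) _ = All.replicate⁺ l ≤-refl ∷ pad-below M [] ν []
pad-below M (s ∷ S) (l ∷ ν) (s<M ∷ S<M) = All.++⁺ s<M (All.replicate⁺ _ ≤-refl) ∷ pad-below M S ν S<M

ssyt-below : ∀ {M T} → SSYT M T → AllBelow M T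
ssyt-below empty = []
ssyt-below (extend {M} {T} {ν} t _ _) = pad-below M T ν (All.map (All.map m<n⇒m<1+n) (ssyt-below t))

extend-addBox : ∀ {M S ν} c → SSYT M S → HorizontalStrip (shape S) (addBox c ν) → Positive ν →
  SSYT (suc M) (pad M S (addBox c ν))
extend-addBox {ν = ν} c t s pos = extend t s (addBox-positive c ν pos c≤n)
  where c≤n = partition-addBox⇒≤length c ν (strip⇒partition s)

strip-insert : ∀ {M T ν} y → SSYT M T → SSYT M (insert y T) → HorizontalStrip (shape T) ν →
  HorizontalStrip (shape (insert y T)) (addBox (rowTarget (newRow y T) (shape T) ν) ν)
strip-insert {T = T} {ν} y t t′ s =
  subst (λ μ′ → HorizontalStrip μ′ (addBox (rowTarget (newRow y T) (shape T) ν) ν)) (sym (shape-insert y T))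
    (strip-addBox-rowTarget (newRow y T) (shape T) ν s (subst IsPartition (shape-insert y T) (ssyt-partition t′)))

insert-ssyt : ∀ {M T} y → SSYT M T → y < M → SSYT M (insert y T)
insert-ssyt {suc M} y (extend {T = T₀} {ν} t s pos) y<1+M with m≤n⇒m<n∨m≡n (≤-pred y<1+M)
... | inj₂ refl = subst (SSYT (suc M)) (sym (proj₁ (insert-top-pad M T₀ ν (ssyt-below t) (fits-in-strip t s))))
                    (extend-addBox 0 t (strip-addBox-0 (shape T₀) ν s) pos)
... | inj₁ y<M = subst (SSYT (suc M)) (sym (proj₁ (insert-pad M y T₀ ν y<M (ssyt-below t) (fits-in-strip t s))))
                   (extend-addBox _ t′ (strip-insert y t t′ s) pos)
  where t′ = insert-ssyt y t y<M

-- Inserting the largest letter leaves the inner tableau unchanged; the first empty row, length μ,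
-- then plays the role of the row of its new box.
keepInner : Tableau → Tableau × ℕ
keepInner T = T , length (shape T)

liftToStrip : ℕ → (Tableau → Tableau × ℕ) → Tableau → Tableau × ℕ
liftToStrip M f T = pad M (proj₁ (f T₀)) (addBox c (shape T)) , c
  where
  T₀ = restrict M T
  c = columnTarget (proj₂ (f T₀)) (shape T₀) (shape T)

-- Column insertion of x into a tableau with entries ≤ M, returning the row of the new box. It is
-- never compared with the bumping algorithm: only its value on [] and its commutation with row
-- insertion are used.
columnInsert : ℕ → ℕ → Tableau → Tableau × ℕ
innerInsert : ℕ → ℕ → Tableau → Tableau × ℕ

columnInsert M x = liftToStrip M (innerInsert M x)

innerInsert zero x = keepInner
innerInsert (suc M) x = if x ≤ᵇ M then columnInsert M x else keepInner

innerInsert-below : ∀ M x → x ≤ M → innerInsert (suc M) x ≡ columnInsert M x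
innerInsert-below M x x≤M with x ≤ᵇ M | ≤⇒≤ᵇ x≤M
... | true | _ = refl

innerInsert-top : ∀ M → innerInsert M M ≡ keepInner
innerInsert-top zero = refl
innerInsert-top (suc M) with suc M ≤ᵇ M | ≤ᵇ⇒≤ (suc M) M
... | true | 1+M≤M = ⊥-elim (1+n≰n (1+M≤M tt))
... | false | _ = refl

liftToStrip-pad : ∀ M f {T₀ ν} → SSYT M T₀ → HorizontalStrip (shape T₀) ν →
  let c = columnTarget (proj₂ (f T₀)) (shape T₀) ν in
  liftToStrip M f (pad M T₀ ν) ≡ (pad M (proj₁ (f T₀)) (addBox c ν) , c)
liftToStrip-pad M f {T₀} {ν} t s
  rewrite restrict-pad M T₀ ν (ssyt-below t) (ssyt-positive t) (fits-in-strip t s) | shape-extend t s = refl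

AddsBox : ℕ → Tableau → Tableau × ℕ → Set
AddsBox M T (S , b) = SSYT M S × shape S ≡ addBox b (shape T)

strip-addsBox : ∀ {M T₀ ν} S b → AddsBox M T₀ (S , b) → HorizontalStrip (shape T₀) ν →
  HorizontalStrip (shape S) (addBox (columnTarget b (shape T₀) ν) ν)
strip-addsBox {T₀ = T₀} {ν} S b (tS , shapeS) s =
  subst (λ μ′ → HorizontalStrip μ′ (addBox (columnTarget b (shape T₀) ν) ν)) (sym shapeS)
    (strip-addBox-columnTarget b (shape T₀) ν s (subst IsPartition shapeS (ssyt-partition tS)))

columnInsert-ssyt : ∀ M x {T} → SSYT (suc M) T → x ≤ M → AddsBox (suc M) T (columnInsert M x T)
innerInsert-strip : ∀ M x {T₀ ν} → SSYT M T₀ → HorizontalStrip (shape T₀) ν → x ≤ M →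
  let (S , b) = innerInsert M x T₀ in
  SSYT M S × HorizontalStrip (shape S) (addBox (columnTarget b (shape T₀) ν) ν)

innerInsert-strip M x {T₀} {ν} t s x≤M with m≤n⇒m<n∨m≡n x≤M
... | inj₂ refl rewrite innerInsert-top M = t , strip-columnTarget (length (shape T₀)) (shape T₀) ν s
innerInsert-strip (suc M) x {T₀} t s _ | inj₁ x<1+M rewrite innerInsert-below M x (≤-pred x<1+M) =
  proj₁ ih , strip-addsBox _ _ ih s
  where ih = columnInsert-ssyt M x t (≤-pred x<1+M)

columnInsert-ssyt M x (extend {T = T₀} {ν} t s pos) x≤M =
  subst (AddsBox (suc M) (pad M T₀ ν)) (sym (liftToStrip-pad M (innerInsert M x) t s))
    (extend-addBox c tS sS pos , trans (shape-extend tS sS) (cong (addBox c) (sym (shape-extend t s))))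
  where
  c = columnTarget (proj₂ (innerInsert M x T₀)) (shape T₀) ν
  tS = proj₁ (innerInsert-strip M x t s x≤M)
  sS = proj₂ (innerInsert-strip M x t s x≤M)

-- Column insertion commutes with row insertion

-- The second component strengthens the induction: when both insertions add their box in the same
-- row p, inserting y after the column insertion adds its box in row p, or in row p + 1 if rows p
-- and p + 1 have equal length.
CommutesWithInsert : (Tableau → Tableau × ℕ) → ℕ → Tableau → Set
CommutesWithInsert f y T =
  proj₁ (f (insert y T)) ≡ insert y (proj₁ (f T))
  × (newRow y T ≡ proj₂ (f T) → ShiftedRow (shape T) (newRow y T) (newRow y (proj₁ (f T))))

shiftedRow-cong : ∀ {ν ν′ p p′ q q′} → ν ≡ ν′ → p ≡ p′ → q ≡ q′ → ShiftedRow ν p q → ShiftedRow ν′ p′ q′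
shiftedRow-cong refl refl refl shifted = shifted

liftToStrip-commutes-top : ∀ M (f : Tableau → Tableau × ℕ) {T₀ ν} → SSYT M T₀ → HorizontalStrip (shape T₀) ν →
  let (S , b) = f T₀ in
  SSYT M S → HorizontalStrip (shape S) (addBox (columnTarget b (shape T₀) ν) ν) →
  CommutesWithInsert (liftToStrip M f) M (pad M T₀ ν)
liftToStrip-commutes-top M f {T₀} {ν} t s tS sS = first , λ _ → inj₁ (trans (proj₂ insS) (sym (proj₂ insT)))
  where
  open ≡-Reasoning
  μ = shape T₀
  S = proj₁ (f T₀)
  b = proj₂ (f T₀)
  c = columnTarget b μ ν
  insT = insert-top-pad M T₀ ν (ssyt-below t) (fits-in-strip t s)
  insS = subst (λ p → insert M (proj₁ p) ≡ pad M S (addBox 0 (addBox c ν)) × newRow M (proj₁ p) ≡ 0)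
           (sym (liftToStrip-pad M f t s)) (insert-top-pad M S (addBox c ν) (ssyt-below tS) (fits-in-strip tS sS))
  first : proj₁ (liftToStrip M f (insert M (pad M T₀ ν))) ≡ insert M (proj₁ (liftToStrip M f (pad M T₀ ν)))
  first = begin
    proj₁ (liftToStrip M f (insert M (pad M T₀ ν)))          ≡⟨ cong (proj₁ ∘ liftToStrip M f) (proj₁ insT) ⟩
    proj₁ (liftToStrip M f (pad M T₀ (addBox 0 ν)))          ≡⟨ cong proj₁ (liftToStrip-pad M f t (strip-addBox-0 μ ν s)) ⟩
    pad M S (addBox (columnTarget b μ (addBox 0 ν)) (addBox 0 ν))
      ≡⟨ cong (λ c′ → pad M S (addBox c′ (addBox 0 ν))) (columnTarget-addBox-0 b μ ν) ⟩
    pad M S (addBox c (addBox 0 ν))                          ≡⟨ cong (pad M S) (addBox-comm c 0 ν) ⟩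
    pad M S (addBox 0 (addBox c ν))                          ≡⟨ proj₁ insS ⟨
    insert M (proj₁ (liftToStrip M f (pad M T₀ ν)))          ∎

liftToStrip-keepInner-commutes : ∀ M y {T₀ ν} → SSYT M T₀ → HorizontalStrip (shape T₀) ν → y < M →
  CommutesWithInsert (liftToStrip M keepInner) y (pad M T₀ ν)
liftToStrip-keepInner-commutes M y {T₀} {ν} t s y<M = first , second
  where
  open ≡-Reasoning
  μ = shape T₀
  a = newRow y T₀
  r = rowTarget a μ ν
  c = columnTarget (length μ) μ ν
  r′ = rowTarget a μ (addBox c ν)
  μ′ = shape (insert y T₀)
  t′ = insert-ssyt y t y<M
  s′ = strip-insert y t t′ s
  top = strips-commute-top μ ν a s (subst IsPartition (shape-insert y T₀) (ssyt-partition t′))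
  lifted = liftToStrip-pad M keepInner t s
  insT = insert-pad M y T₀ ν y<M (ssyt-below t) (fits-in-strip t s)
  insC = insert-pad M y T₀ (addBox c ν) y<M (ssyt-below t) (fits-in-strip t (strip-columnTarget (length μ) μ ν s))
  first : proj₁ (liftToStrip M keepInner (insert y (pad M T₀ ν))) ≡ insert y (proj₁ (liftToStrip M keepInner (pad M T₀ ν)))
  first = begin
    proj₁ (liftToStrip M keepInner (insert y (pad M T₀ ν)))            ≡⟨ cong (proj₁ ∘ liftToStrip M keepInner) (proj₁ insT) ⟩
    proj₁ (liftToStrip M keepInner (pad M (insert y T₀) (addBox r ν)))  ≡⟨ cong proj₁ (liftToStrip-pad M keepInner t′ s′) ⟩
    pad M (insert y T₀) (addBox (columnTarget (length μ′) μ′ (addBox r ν)) (addBox r ν))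
      ≡⟨ cong (λ μ″ → pad M (insert y T₀) (addBox (columnTarget (length μ″) μ″ (addBox r ν)) (addBox r ν)))
              (shape-insert y T₀) ⟩
    pad M (insert y T₀) (addBox (columnTarget (length (addBox a μ)) (addBox a μ) (addBox r ν)) (addBox r ν))
      ≡⟨ cong (pad M (insert y T₀)) (proj₁ top) ⟩
    pad M (insert y T₀) (addBox r′ (addBox c ν))                        ≡⟨ proj₁ insC ⟨
    insert y (pad M T₀ (addBox c ν))                                    ≡⟨ cong (insert y ∘ proj₁) lifted ⟨
    insert y (proj₁ (liftToStrip M keepInner (pad M T₀ ν)))             ∎
  second : newRow y (pad M T₀ ν) ≡ proj₂ (liftToStrip M keepInner (pad M T₀ ν)) →
    ShiftedRow (shape (pad M T₀ ν)) (newRow y (pad M T₀ ν)) (newRow y (proj₁ (liftToStrip M keepInner (pad M T₀ ν))))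
  second e = shiftedRow-cong (sym (shape-extend t s)) (sym (proj₂ insT))
    (sym (trans (cong (newRow y ∘ proj₁) lifted) (proj₂ insC)))
    (proj₂ top (trans (sym (proj₂ insT)) (trans e (cong proj₂ lifted))))

liftToStrip-commutes : ∀ M (f : Tableau → Tableau × ℕ) y {T₀ ν} → SSYT M T₀ → HorizontalStrip (shape T₀) ν → y < M →
  AddsBox M T₀ (f T₀) → AddsBox M (insert y T₀) (f (insert y T₀)) → CommutesWithInsert f y T₀ →
  CommutesWithInsert (liftToStrip M f) y (pad M T₀ ν)
liftToStrip-commutes M f y {T₀} {ν} t s y<M fT₀ fyT₀ ih = first , second
  where
  open ≡-Reasoning
  μ = shape T₀
  a = newRow y T₀
  r = rowTarget a μ ν
  S = proj₁ (f T₀)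
  b = proj₂ (f T₀)
  c = columnTarget b μ ν
  S′ = proj₁ (f (insert y T₀))
  b′ = proj₂ (f (insert y T₀))
  a′ = newRow y S
  t′ = insert-ssyt y t y<M
  s′ = strip-insert y t t′ s
  sS = strip-addsBox S b fT₀ s
  shapeS′ : shape S′ ≡ addBox b′ (addBox a μ)
  shapeS′ = trans (proj₂ fyT₀) (cong (addBox b′) (shape-insert y T₀))
  inner-commute : addBox b′ (addBox a μ) ≡ addBox a′ (addBox b μ)
  inner-commute = begin
    addBox b′ (addBox a μ)    ≡⟨ shapeS′ ⟨
    shape S′                  ≡⟨ cong shape (proj₁ ih) ⟩
    shape (insert y S)        ≡⟨ shape-insert y S ⟩
    addBox a′ (shape S)       ≡⟨ cong (addBox a′) (proj₂ fT₀) ⟩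
    addBox a′ (addBox b μ)    ∎
  outer = strips-commute μ ν a b a′ b′ s
    (subst IsPartition (shape-insert y T₀) (ssyt-partition t′))
    (subst IsPartition shapeS′ (ssyt-partition (proj₁ fyT₀)))
    inner-commute (proj₂ ih)
  lifted = liftToStrip-pad M f t s
  insT = insert-pad M y T₀ ν y<M (ssyt-below t) (fits-in-strip t s)
  insS = insert-pad M y S (addBox c ν) y<M (ssyt-below (proj₁ fT₀)) (fits-in-strip (proj₁ fT₀) sS)
  first : proj₁ (liftToStrip M f (insert y (pad M T₀ ν))) ≡ insert y (proj₁ (liftToStrip M f (pad M T₀ ν)))
  first = begin
    proj₁ (liftToStrip M f (insert y (pad M T₀ ν)))                  ≡⟨ cong (proj₁ ∘ liftToStrip M f) (proj₁ insT) ⟩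
    proj₁ (liftToStrip M f (pad M (insert y T₀) (addBox r ν)))        ≡⟨ cong proj₁ (liftToStrip-pad M f t′ s′) ⟩
    pad M S′ (addBox (columnTarget b′ (shape (insert y T₀)) (addBox r ν)) (addBox r ν))
      ≡⟨ cong₂ (λ S″ μ′ → pad M S″ (addBox (columnTarget b′ μ′ (addBox r ν)) (addBox r ν)))
               (proj₁ ih) (shape-insert y T₀) ⟩
    pad M (insert y S) (addBox (columnTarget b′ (addBox a μ) (addBox r ν)) (addBox r ν))
      ≡⟨ cong (pad M (insert y S)) (proj₁ outer) ⟩
    pad M (insert y S) (addBox (rowTarget a′ (addBox b μ) (addBox c ν)) (addBox c ν))
      ≡⟨ cong (λ μ′ → pad M (insert y S) (addBox (rowTarget a′ μ′ (addBox c ν)) (addBox c ν)))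
              (proj₂ fT₀) ⟨
    pad M (insert y S) (addBox (rowTarget a′ (shape S) (addBox c ν)) (addBox c ν))
      ≡⟨ proj₁ insS ⟨
    insert y (pad M S (addBox c ν))                                   ≡⟨ cong (insert y ∘ proj₁) lifted ⟨
    insert y (proj₁ (liftToStrip M f (pad M T₀ ν)))                   ∎
  second : newRow y (pad M T₀ ν) ≡ proj₂ (liftToStrip M f (pad M T₀ ν)) →
    ShiftedRow (shape (pad M T₀ ν)) (newRow y (pad M T₀ ν)) (newRow y (proj₁ (liftToStrip M f (pad M T₀ ν))))
  second e = shiftedRow-cong (sym (shape-extend t s)) (sym (proj₂ insT))
    (sym (trans (cong (newRow y ∘ proj₁) lifted)
                (trans (proj₂ insS) (cong (λ μ′ → rowTarget a′ μ′ (addBox c ν)) (proj₂ fT₀)))))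
    (proj₂ outer (trans (sym (proj₂ insT)) (trans e (cong proj₂ lifted))))

columnInsert-commutes : ∀ M x y {T} → SSYT (suc M) T → x ≤ M → y ≤ M → CommutesWithInsert (columnInsert M x) y T
columnInsert-commutes M x y (extend t s pos) x≤M y≤M with m≤n⇒m<n∨m≡n y≤M
... | inj₂ refl = liftToStrip-commutes-top M (innerInsert M x) t s
                    (proj₁ (innerInsert-strip M x t s x≤M)) (proj₂ (innerInsert-strip M x t s x≤M))
... | inj₁ y<M with m≤n⇒m<n∨m≡n x≤M
...   | inj₂ refl rewrite innerInsert-top M = liftToStrip-keepInner-commutes M y t s y<M
columnInsert-commutes (suc M) x y (extend t s pos) _ _ | inj₁ y<1+M | inj₁ x<1+M
  rewrite innerInsert-below M x (≤-pred x<1+M) =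
  liftToStrip-commutes (suc M) (columnInsert M x) y t s y<1+M
    (columnInsert-ssyt M x t x≤M) (columnInsert-ssyt M x (insert-ssyt y t y<1+M) x≤M)
    (columnInsert-commutes M x y t x≤M (≤-pred y<1+M))
  where x≤M = ≤-pred x<1+M

insertAll : Tableau → Word → Tableau
insertAll = foldl (λ T x → insert x T)

ssyt-empty : ∀ M → SSYT M []
ssyt-empty zero = empty
ssyt-empty (suc M) = extend (ssyt-empty M) (strip (λ _ → z≤n) (λ _ → z≤n)) []

insertAll-ssyt : ∀ {M T} w → SSYT M T → All (_< M) w → SSYT M (insertAll T w)
insertAll-ssyt [] t [] = t
insertAll-ssyt (y ∷ w) t (y<M ∷ w<M) = insertAll-ssyt w (insert-ssyt y t y<M) w<M

columnInsert-[] : ∀ M x → x ≤ M → proj₁ (columnInsert M x []) ≡ [ [ x ] ]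
columnInsert-[] M x x≤M with m≤n⇒m<n∨m≡n x≤M
... | inj₂ refl rewrite innerInsert-top M = refl
columnInsert-[] (suc M) x _ | inj₁ x<1+M
  rewrite innerInsert-below M x (≤-pred x<1+M)
        | columnInsert-[] M x (≤-pred x<1+M)
        | columnTarget-unique (proj₂ (columnInsert M x [])) [] [] z≤n tt (λ _ _ _ → z≤n) = refl

columnInsert-insertAll : ∀ M x w {T} → SSYT (suc M) T → All (_≤ M) w → x ≤ M →
  insertAll (proj₁ (columnInsert M x T)) w ≡ proj₁ (columnInsert M x (insertAll T w))
columnInsert-insertAll M x [] t [] x≤M = refl
columnInsert-insertAll M x (y ∷ w) {T} t (y≤M ∷ w≤M) x≤M =
  trans (cong (λ T′ → insertAll T′ w) (sym (proj₁ (columnInsert-commutes M x y t x≤M y≤M))))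
        (columnInsert-insertAll M x w (insert-ssyt y t (s≤s y≤M)) w≤M x≤M)

P-∷ : ∀ M x w → All (_≤ M) w → x ≤ M → P (x ∷ w) ≡ proj₁ (columnInsert M x (P w))
P-∷ M x w w≤M x≤M = trans (cong (λ T → insertAll T w) (sym (columnInsert-[] M x x≤M)))
                          (columnInsert-insertAll M x w (ssyt-empty (suc M)) w≤M x≤M)

P-∷ʳ : ∀ w u → P (w ++ [ u ]) ≡ insert u (P w)
P-∷ʳ w u = foldl-++ (λ T x → insert x T) [] w [ u ]

-- Columns containing a letter

at-++-< : ∀ (s ys : List ℕ) {j} → j < length s → (s ++ ys) at j ≡ s at j
at-++-< (x ∷ s) ys {zero} _ = refl
at-++-< (x ∷ s) ys {suc j} (s≤s j<n) = at-++-< s ys j<n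

at-++-≥ : ∀ (s ys : List ℕ) {j} → length s ≤ j → (s ++ ys) at j ≡ ys at (j ∸ length s)
at-++-≥ [] ys _ = refl
at-++-≥ (x ∷ s) ys {suc j} (s≤s n≤j) = at-++-≥ s ys n≤j

at-beyond : ∀ (r : List ℕ) {j} → length r ≤ j → r at j ≡ nothing
at-beyond [] _ = refl
at-beyond (x ∷ r) {suc j} (s≤s n≤j) = at-beyond r n≤j

at-replicate-< : ∀ k (L : ℕ) {j} → j < k → replicate k L at j ≡ just L
at-replicate-< (suc k) L {zero} _ = refl
at-replicate-< (suc k) L {suc j} (s≤s j<k) = at-replicate-< k L j<k

at-replicate : ∀ k (L : ℕ) {j v} → replicate k L at j ≡ just v → v ≡ L × j < k
at-replicate (suc k) L {zero} refl = refl , s≤s z≤n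
at-replicate (suc k) L {suc j} e = map₂ s≤s (at-replicate k L e)

at-All : ∀ {Q : ℕ → Set} (s : List ℕ) {j v} → All Q s → s at j ≡ just v → Q v
at-All (x ∷ s) {zero} (q ∷ _) refl = q
at-All (x ∷ s) {suc j} (_ ∷ qs) e = at-All s qs e

padded-row-top : ∀ L (s : List ℕ) k {j} → length s ≤ j → j < length s + k → (s ++ replicate k L) at j ≡ just L
padded-row-top L s k {j} n≤j j<n+k = trans (at-++-≥ s _ n≤j) (at-replicate-< k L
  (+-cancelˡ-< (length s) (j ∸ length s) k (subst (_< length s + k) (sym (m+[n∸m]≡n n≤j)) j<n+k)))

padded-row-top⁻¹ : ∀ L (s : List ℕ) k {j} → All (_< L) s → (s ++ replicate k L) at j ≡ just L →
  length s ≤ j × j < length s + k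
padded-row-top⁻¹ L s k {j} s<L e with j <? length s
... | yes j<n = ⊥-elim (<-irrefl refl (at-All s s<L (trans (sym (at-++-< s _ j<n)) e)))
... | no j≮n = n≤j , subst (_< length s + k) (m+[n∸m]≡n n≤j) (+-monoʳ-< (length s) j∸n<k)
  where
  n≤j = ≮⇒≥ j≮n
  j∸n<k = proj₂ (at-replicate k L (trans (sym (at-++-≥ s _ n≤j)) e))

StripCovers : Shape → Shape → ℕ → Set
StripCovers μ ν j = ∃[ i ] (μ ! i ≤ j × j < ν ! i)

columnContains-pad-top : ∀ L T₀ ν j → AllBelow L T₀ → FitsIn T₀ ν →
  ColumnContains (pad L T₀ ν) j L ⇔ StripCovers (shape T₀) ν j
columnContains-pad-top L T₀ ν j T₀<L fits = mk⇔ (to T₀ ν T₀<L fits) (from T₀ ν fits)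
  where
  to : ∀ S ν → AllBelow L S → FitsIn S ν → ColumnContains (pad L S ν) j L → StripCovers (shape S) ν j
  to [] (l ∷ ν) _ _ (here e) = 0 , padded-row-top⁻¹ L [] l [] e
  to (s ∷ S) (l ∷ ν) (s<L ∷ _) (s≤l , _) (here e) with padded-row-top⁻¹ L s (l ∸ length s) s<L e
  ... | n≤j , j<l = 0 , n≤j , subst (j <_) (m+[n∸m]≡n s≤l) j<l
  to [] (l ∷ ν) _ _ (there c) with to [] ν [] tt c
  ... | i , covers = suc i , covers
  to (s ∷ S) (l ∷ ν) (_ ∷ S<L) (_ , fits) (there c) with to S ν S<L fits c
  ... | i , covers = suc i , covers
  from : ∀ S ν → FitsIn S ν → StripCovers (shape S) ν j → ColumnContains (pad L S ν) j L
  from [] (l ∷ ν) _ (zero , _ , j<l) = here (padded-row-top L [] l z≤n j<l)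
  from [] (l ∷ ν) _ (suc i , _ , j<νi) = there (from [] ν tt (i , z≤n , j<νi))
  from (s ∷ S) (l ∷ ν) (s≤l , _) (zero , n≤j , j<l) =
    here (padded-row-top L s (l ∸ length s) n≤j (subst (j <_) (sym (m+[n∸m]≡n s≤l)) j<l))
  from (s ∷ S) (l ∷ ν) (_ , fits) (suc i , covers) = there (from S ν fits (i , covers))

columnContains-pad-below : ∀ L u T₀ ν j → u < L → FitsIn T₀ ν →
  ColumnContains (pad L T₀ ν) j u ⇔ ColumnContains T₀ j u
columnContains-pad-below L u T₀ ν j u<L fits = mk⇔ (to T₀ ν fits) (from T₀ ν fits)
  where
  not-L : ∀ k {i} → ¬ replicate k L at i ≡ just u
  not-L k e = <-irrefl (proj₁ (at-replicate k L e)) u<L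
  to : ∀ S ν → FitsIn S ν → ColumnContains (pad L S ν) j u → ColumnContains S j u
  to [] (l ∷ ν) _ (here e) = ⊥-elim (not-L l e)
  to [] (l ∷ ν) _ (there c) = to [] ν tt c
  to (s ∷ S) (l ∷ ν) _ (here e) with j <? length s
  ... | yes j<n = here (trans (sym (at-++-< s _ j<n)) e)
  ... | no j≮n = ⊥-elim (not-L (l ∸ length s) (trans (sym (at-++-≥ s _ (≮⇒≥ j≮n))) e))
  to (s ∷ S) (l ∷ ν) (_ , fits) (there c) = there (to S ν fits c)
  from : ∀ S ν → FitsIn S ν → ColumnContains S j u → ColumnContains (pad L S ν) j u
  from (s ∷ S) (l ∷ ν) _ (here e) with j <? length s
  ... | yes j<n = here (trans (at-++-< s _ j<n) e)
  ... | no j≮n with () ← trans (sym (at-beyond s (≮⇒≥ j≮n))) e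
  from (s ∷ S) (l ∷ ν) (_ , fits) (there c) = there (from S ν fits c)

everyColumnContains⇔ : ∀ T u → EveryColumnContains T u ⇔ (∀ j → j < shape T ! 0 → ColumnContains T j u)
everyColumnContains⇔ [] u = mk⇔ (λ _ _ ()) (λ _ → tt)
everyColumnContains⇔ (r ∷ T) u = mk⇔ id id

columnContains⇒< : ∀ T {j u} → IsPartition (shape T) → ColumnContains T j u → j < shape T ! 0
columnContains⇒< (r ∷ T) {j} P (here e) with j <? length r
... | yes j<n = j<n
... | no j≮n with () ← trans (sym (at-beyond r (≮⇒≥ j≮n))) e
columnContains⇒< (r ∷ T) P (there c) = <-≤-trans (columnContains⇒< T (P ∘ suc) c) (P 0)

strip-covers⇒flush : ∀ μ ν → IsPartition μ → HorizontalStrip μ ν → (∀ j → j < ν ! 0 → StripCovers μ ν j) →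
  ∀ k → Flush μ ν k
strip-covers⇒flush μ ν Pμ s covers k with μ ! k ≤? ν ! suc k
... | yes flush = flush
... | no ¬flush with covers (ν ! suc k) (<-≤-trans (≰⇒> ¬flush) (≤-trans (partition-antitone μ Pμ z≤n) (inside s 0)))
...   | i , μi≤ , <νi with i ≤? k
...     | yes i≤k = ⊥-elim (¬flush (≤-trans (partition-antitone μ Pμ i≤k) μi≤))
...     | no i≰k = ⊥-elim (<-irrefl refl (<-≤-trans <νi (partition-antitone ν (strip⇒partition s) (≰⇒> i≰k))))

flush⇒strip-covers : ∀ μ ν → (∀ k → k < length μ → Flush μ ν k) → ∀ j → j < ν ! 0 → StripCovers μ ν j
flush⇒strip-covers μ ν flush j = search (length μ) 0 refl
  where
  search : ∀ n i → i + n ≡ length μ → j < ν ! i → StripCovers μ ν j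
  search zero i i+0≡n j<νi =
    i , subst (_≤ j) (sym (!-beyond μ (≤-reflexive (trans (sym i+0≡n) (+-identityʳ i))))) z≤n , j<νi
  search (suc n) i i+1+n≡n j<νi with μ ! i ≤? j
  ... | yes μi≤j = i , μi≤j , j<νi
  ... | no μi≰j = search n (suc i) (trans (sym (+-suc i n)) i+1+n≡n)
                    (<-≤-trans (≰⇒> μi≰j) (flush i (subst (i <_) i+1+n≡n (m<m+n i (s≤s z≤n)))))

strip-covers⇔ : ∀ μ ν → IsPartition μ → HorizontalStrip μ ν →
  (∀ j → j < ν ! 0 → StripCovers μ ν j) ⇔ columnTarget (length μ) μ ν ≡ 0
strip-covers⇔ μ ν Pμ s = mk⇔
  (λ covers → columnTarget-unique (length μ) μ ν z≤n tt (λ k _ _ → strip-covers⇒flush μ ν Pμ s covers k))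
  (λ c≡0 → flush⇒strip-covers μ ν λ k k<n →
     columnTarget-flush-above (length μ) μ ν (subst (_≤ k) (sym c≡0) z≤n) k<n)

everyColumnContains-pad-top : ∀ L {T₀ ν} → SSYT L T₀ → HorizontalStrip (shape T₀) ν →
  EveryColumnContains (pad L T₀ ν) L ⇔ columnTarget (length (shape T₀)) (shape T₀) ν ≡ 0
everyColumnContains-pad-top L {T₀} {ν} t s = mk⇔
  (λ every → Equivalence.to (strip-covers⇔ μ ν (ssyt-partition t) s) λ j j<ν₀ →
     Equivalence.to (contains j) (Equivalence.to (everyColumnContains⇔ T L) every j (subst (j <_) (sym ν₀≡) j<ν₀)))
  (λ c≡0 → Equivalence.from (everyColumnContains⇔ T L) λ j j<T₀ →
     Equivalence.from (contains j)
       (Equivalence.from (strip-covers⇔ μ ν (ssyt-partition t) s) c≡0 j (subst (j <_) ν₀≡ j<T₀)))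
  where
  μ = shape T₀
  T = pad L T₀ ν
  ν₀≡ : shape T ! 0 ≡ ν ! 0
  ν₀≡ = cong (_! 0) (shape-extend t s)
  contains = λ j → columnContains-pad-top L T₀ ν j (ssyt-below t) (fits-in-strip t s)

everyColumnContains-pad-below : ∀ L u {T₀ ν} → u < L → SSYT L T₀ → HorizontalStrip (shape T₀) ν →
  EveryColumnContains (pad L T₀ ν) u ⇔ (EveryColumnContains T₀ u × shape T₀ ! 0 ≡ ν ! 0)
everyColumnContains-pad-below L u {T₀} {ν} u<L t s = mk⇔ to from
  where
  μ = shape T₀
  T = pad L T₀ ν
  ν₀≡ : shape T ! 0 ≡ ν ! 0
  ν₀≡ = cong (_! 0) (shape-extend t s)
  contains = λ j → columnContains-pad-below L u T₀ ν j u<L (fits-in-strip t s)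
  to : EveryColumnContains T u → EveryColumnContains T₀ u × μ ! 0 ≡ ν ! 0
  to every = Equivalence.from (everyColumnContains⇔ T₀ u) (λ j j<μ₀ → in-T₀ j (<-≤-trans j<μ₀ (inside s 0))) ,
             ≤-antisym (inside s 0) (≮⇒≥ λ μ₀<ν₀ →
               <-irrefl refl (columnContains⇒< T₀ (ssyt-partition t) (in-T₀ (μ ! 0) μ₀<ν₀)))
    where
    in-T₀ : ∀ j → j < ν ! 0 → ColumnContains T₀ j u
    in-T₀ j j<ν₀ = Equivalence.to (contains j)
      (Equivalence.to (everyColumnContains⇔ T u) every j (subst (j <_) (sym ν₀≡) j<ν₀))
  from : EveryColumnContains T₀ u × μ ! 0 ≡ ν ! 0 → EveryColumnContains T u
  from (every , μ₀≡ν₀) = Equivalence.from (everyColumnContains⇔ T u) λ j j<T₀ →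
    Equivalence.from (contains j)
      (Equivalence.to (everyColumnContains⇔ T₀ u) every j (subst (j <_) (trans ν₀≡ (sym μ₀≡ν₀)) j<T₀))

AgreesWithRowInsert : ℕ → Tableau → Tableau → Set
AgreesWithRowInsert u T C =
  (C ≡ insert u T → EveryColumnContains T u × newRow u T ≡ 0) × (EveryColumnContains T u → C ≡ insert u T)

keepInner-agrees : ∀ M {T₀ ν} → SSYT M T₀ → HorizontalStrip (shape T₀) ν →
  AgreesWithRowInsert M (pad M T₀ ν) (proj₁ (liftToStrip M keepInner (pad M T₀ ν)))
keepInner-agrees M {T₀} {ν} t s = fwd , bwd
  where
  μ = shape T₀
  c = columnTarget (length μ) μ ν
  lifted : proj₁ (liftToStrip M keepInner (pad M T₀ ν)) ≡ pad M T₀ (addBox c ν)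
  lifted = cong proj₁ (liftToStrip-pad M keepInner t s)
  insT = insert-top-pad M T₀ ν (ssyt-below t) (fits-in-strip t s)
  fwd : _ ≡ insert M (pad M T₀ ν) → EveryColumnContains (pad M T₀ ν) M × newRow M (pad M T₀ ν) ≡ 0
  fwd e = Equivalence.from (everyColumnContains-pad-top M t s) (addBox-injective ν shapes) , proj₂ insT
    where
    shapes : addBox c ν ≡ addBox 0 ν
    shapes = begin
      addBox c ν                              ≡⟨ shape-extend t (strip-columnTarget (length μ) μ ν s) ⟨
      shape (pad M T₀ (addBox c ν))           ≡⟨ cong shape (trans (sym lifted) (trans e (proj₁ insT))) ⟩
      shape (pad M T₀ (addBox 0 ν))           ≡⟨ shape-extend t (strip-addBox-0 μ ν s) ⟩
      addBox 0 ν                              ∎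
      where open ≡-Reasoning
  bwd : EveryColumnContains (pad M T₀ ν) M → _ ≡ insert M (pad M T₀ ν)
  bwd every = trans lifted (trans (cong (λ c′ → pad M T₀ (addBox c′ ν)) c≡0) (sym (proj₁ insT)))
    where c≡0 = Equivalence.to (everyColumnContains-pad-top M t s) every

liftToStrip-agrees : ∀ M (f : Tableau → Tableau × ℕ) u {T₀ ν} → SSYT M T₀ → HorizontalStrip (shape T₀) ν → u < M →
  AddsBox M T₀ (f T₀) → AgreesWithRowInsert u T₀ (proj₁ (f T₀)) →
  AgreesWithRowInsert u (pad M T₀ ν) (proj₁ (liftToStrip M f (pad M T₀ ν)))
liftToStrip-agrees M f u {T₀} {ν} t s u<M fT₀ ih = fwd , bwd
  where
  μ = shape T₀
  S = proj₁ (f T₀)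
  b = proj₂ (f T₀)
  c = columnTarget b μ ν
  a = newRow u T₀
  r = rowTarget a μ ν
  tS = proj₁ fT₀
  sS = strip-addsBox S b fT₀ s
  t′ = insert-ssyt u t u<M
  s′ = strip-insert u t t′ s
  lifted : proj₁ (liftToStrip M f (pad M T₀ ν)) ≡ pad M S (addBox c ν)
  lifted = cong proj₁ (liftToStrip-pad M f t s)
  insT = insert-pad M u T₀ ν u<M (ssyt-below t) (fits-in-strip t s)
  c≡0 : S ≡ insert u T₀ → a ≡ 0 → c ≡ 0
  c≡0 S≡ a≡0 = cong (λ b′ → columnTarget b′ μ ν)
    (trans (addBox-injective μ (trans (sym (proj₂ fT₀)) (trans (cong shape S≡) (shape-insert u T₀)))) a≡0)
  fwd : _ ≡ insert u (pad M T₀ ν) → EveryColumnContains (pad M T₀ ν) u × newRow u (pad M T₀ ν) ≡ 0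
  fwd e = Equivalence.from (everyColumnContains-pad-below M u u<M t s) (everyT₀ , μ₀≡ν₀) , trans (proj₂ insT) r≡0
    where
    padded : pad M S (addBox c ν) ≡ pad M (insert u T₀) (addBox r ν)
    padded = trans (sym lifted) (trans e (proj₁ insT))
    S≡ : S ≡ insert u T₀
    S≡ = trans (sym (restrict-pad M S _ (ssyt-below tS) (ssyt-positive tS) (fits-in-strip tS sS)))
           (trans (cong (restrict M) padded)
                  (restrict-pad M _ _ (ssyt-below t′) (ssyt-positive t′) (fits-in-strip t′ s′)))
    r≡c : r ≡ c
    r≡c = addBox-injective ν (trans (sym (shape-extend t′ s′)) (trans (cong shape (sym padded)) (shape-extend tS sS)))
    everyT₀ = proj₁ (proj₁ ih S≡)
    a≡0 = proj₂ (proj₁ ih S≡)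
    r≡0 = trans r≡c (c≡0 S≡ a≡0)
    μ₀≡ν₀ : μ ! 0 ≡ ν ! 0
    μ₀≡ν₀ = ≤-antisym (inside s 0) (≮⇒≥ λ μ₀<ν₀ →
      0≢1+n (trans (sym r≡0) (trans (cong (λ a′ → rowTarget a′ μ ν) a≡0) (rowTarget-< 0 μ ν μ₀<ν₀))))
  bwd : EveryColumnContains (pad M T₀ ν) u → _ ≡ insert u (pad M T₀ ν)
  bwd every = trans lifted (trans (cong₂ (λ S′ c′ → pad M S′ (addBox c′ ν)) S≡ (trans (c≡0 S≡ a≡0) (sym r≡0)))
                                  (sym (proj₁ insT)))
    where
    split = Equivalence.to (everyColumnContains-pad-below M u u<M t s) every
    S≡ = proj₂ ih (proj₁ split)
    a≡0 = proj₂ (proj₁ ih S≡)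
    r≡0 : r ≡ 0
    r≡0 = trans (cong (λ a′ → rowTarget a′ μ ν) a≡0) (rowTarget-≮ 0 μ ν (<-irrefl (proj₂ split)))

columnInsert-agrees : ∀ M u {T} → SSYT (suc M) T → u ≤ M → AgreesWithRowInsert u T (proj₁ (columnInsert M u T))
columnInsert-agrees M u (extend t s pos) u≤M with m≤n⇒m<n∨m≡n u≤M
... | inj₂ refl rewrite innerInsert-top M = keepInner-agrees M t s
columnInsert-agrees (suc M) u (extend t s pos) _ | inj₁ u<1+M rewrite innerInsert-below M u (≤-pred u<1+M) =
  liftToStrip-agrees (suc M) (columnInsert M u) u t s u<1+M
    (columnInsert-ssyt M u t (≤-pred u<1+M)) (columnInsert-agrees M u t (≤-pred u<1+M))

-- The argument works for all letters in ℕ.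
theorem3p2 : (u : ℕ) → 1 ≤ u → (w : List ℕ) → All (1 ≤_) w →
    ((u ∷ w) ≡K (w ++ u ∷ [])) ⇔ EveryColumnContains (P w) u
theorem3p2 u _ w _ = mk⇔
  (λ uw≡wu → proj₁ (proj₁ agrees (trans (sym cons) (trans uw≡wu snoc))))
  (λ every → trans cons (trans (proj₂ agrees every) (sym snoc)))
  where
  M = max u w
  w≤M = xs≤max u w
  u≤M = ⊥≤max u w
  cons : P (u ∷ w) ≡ proj₁ (columnInsert M u (P w))
  cons = P-∷ M u w w≤M u≤M
  snoc : P (w ++ [ u ]) ≡ insert u (P w)
  snoc = P-∷ʳ w u
  agrees = columnInsert-agrees M u (insertAll-ssyt w (ssyt-empty (suc M)) (All.map s≤s w≤M)) u≤M
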